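{- Let $\mathbb{T}$ be an ordinary algebraic theory. Its monoidal classifying category $\mathbf{T}$ is equivalent, via a product preserving equivalence, to the Cartesian classifying category $\mathbf{K}$ of $\mathbb{T}$.
   Context: Ordinary algebraic theories: over a finitary many-sorted signature $\Sigma$ (atomic types, functional constants $f\colon B_1,\dots,B_n\to B_{n+1}$), types are finite sequences of atomic types; terms $x:A\vdash t:B$ (with $x$ a sequence of distinct atomic variables and $t$ a tensor of ordinary terms) are derived by the rules for variables, functions, substitution, unit, tensor and all three structural rules (weakening, exchange, contraction); formulas $x:A\vdash s=_Bt$ are deduced from axioms by reflexivity, symmetry, transitivity, substitution, tensor and the structural rules. An ordinary algebraic theory $\mathbb{T}$ is such a language with a set of axioms. Monoidal classifying category $\mathbf{T}$: a monoidal category with equivalences $\hom(\mathbf{T},\mathbf{C})\simeq\mathrm{Mod}(\mathbb{T},\mathbf{C})$ natural in the monoidal category $\mathbf{C}$, where $\hom$ denotes strong monoidal functors and monoidal natural transformations, and $\mathrm{Mod}(\mathbb{T},\mathbf{C})$ the category of $\mathbb{T}$-models in $\mathbf{C}$ in the monoidal sense: an interpretation of atomic types by objects, of functional constants by arrows $|f|\colon|B_1|\otimes\dots\otimes|B_n|\to|B_{n+1}|$, and of the structural rules by arrows $\pi_A\colon|A|\to I$, $\sigma_A\colon|\sigma A|\to|A|$, $\Delta_A\colon|A|\to|A|\otimes|A|$, such that the interpretation of each term (computed inductively from a derivation, structural rules acting by precomposition with these arrows) is independent of the derivation, and satisfying all axioms (both sides interpreted by equal arrows). Concretely $\mathbf{T}$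 may be taken to be the category whose objects are types and whose arrows are terms modulo alphabetical variance and provable equality in $\mathbb{T}$. Cartesian classifying category $\mathbf{K}$: a category with finite products such that, for every category $\mathbf{C}$ with finite products, product-preserving functors $\mathbf{K}\to\mathbf{C}$ correspond, up to equivalence naturally in $\mathbf{C}$, to ordinary (classical) $\mathbb{T}$-models in $\mathbf{C}$ (atomic types interpreted as objects, functional constants as arrows out of products, axioms holding in the usual categorical semantics). -}

module Defs where

open import Level using (Level; _⊔_) renaming (suc to lsuc)
open import Data.List using (List; []; _∷_; _++_)
open import Data.Product using (Σ; Σ-syntax; _×_; _,_)
open import Relation.Binary.PropositionalEquality using (_≡_)

-- atomic types (sorts) and functional constants f : B₁,…,Bₙ → Bₙ₊₁
record Signature : Set₁ where
  field
    Sort  : Set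
    Fun   : Set
    arity : Fun → List Sort
    sort  : Fun → Sort

module Syntax (Σ' : Signature) where
  open Signature Σ'

  Type : Set
  Type = List Sort

  -- variables of a context (de Bruijn; this quotients by alphabetical variance)
  data _∋_ : Type → Sort → Set where
    here  : ∀ {Γ s} → (s ∷ Γ) ∋ s
    there : ∀ {Γ s t} → Γ ∋ s → (t ∷ Γ) ∋ s

  mutual
    data Tm (Γ : Type) : Sort → Set where
      var : ∀ {s} → Γ ∋ s → Tm Γ s
      app : (f : Fun) → Tms Γ (arity f) → Tm Γ (sort f)

    -- x : Γ ⊢ t : B  with t a tensor of ordinary terms
    data Tms (Γ : Type) : Type → Set where
      []  : Tms Γ []
      _∷_ : ∀ {s Δ} → Tm Γ s → Tms Γ Δ → Tms Γ (s ∷ Δ)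

  lookup : ∀ {Γ Δ s} → Tms Γ Δ → Δ ∋ s → Tm Γ s
  lookup (t ∷ ts) here      = t
  lookup (t ∷ ts) (there x) = lookup ts x

  -- renamings (generated by weakening, exchange and contraction)
  Ren : Type → Type → Set
  Ren Γ Δ = ∀ {s} → Γ ∋ s → Δ ∋ s

  mutual
    ren : ∀ {Γ Δ s} → Ren Γ Δ → Tm Γ s → Tm Δ s
    ren ρ (var x)    = var (ρ x)
    ren ρ (app f ts) = app f (rens ρ ts)

    rens : ∀ {Γ Δ B} → Ren Γ Δ → Tms Γ B → Tms Δ B
    rens ρ []       = []
    rens ρ (t ∷ ts) = ren ρ t ∷ rens ρ ts

  mutual
    sub : ∀ {Γ Δ s} → Tms Δ Γ → Tm Γ s → Tm Δ s
    sub θ (var x)    = lookup θ x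
    sub θ (app f ts) = app f (subs θ ts)

    subs : ∀ {Γ Δ B} → Tms Δ Γ → Tms Γ B → Tms Δ B
    subs θ []       = []
    subs θ (t ∷ ts) = sub θ t ∷ subs θ ts

  idTms : ∀ {Γ} → Tms Γ Γ
  idTms {[]}    = []
  idTms {s ∷ Γ} = var here ∷ rens there (idTms {Γ})

  _∘ₜ_ : ∀ {A B C} → Tms B C → Tms A B → Tms A C
  u ∘ₜ s = subs s u

  _++ₜ_ : ∀ {Γ B D} → Tms Γ B → Tms Γ D → Tms Γ (B ++ D)
  []       ++ₜ us = us
  (t ∷ ts) ++ₜ us = t ∷ (ts ++ₜ us)

  inl : ∀ {A C} → Ren A (A ++ C)
  inl here      = here
  inl (there x) = there (inl x)

  inr : ∀ {A C} → Ren C (A ++ C)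
  inr {[]}    x = x
  inr {_ ∷ A} x = there (inr {A} x)

  _⊗ₜ_ : ∀ {A B C D} → Tms A B → Tms C D → Tms (A ++ C) (B ++ D)
  _⊗ₜ_ {A} {C = C} s u = rens (inl {A} {C}) s ++ₜ rens (inr {A} {C}) u

record Theory : Set₁ where
  field
    sig : Signature
  open Signature sig public
  open Syntax sig public
  field
    Ax    : Set
    axCtx : Ax → Type
    axTy  : Ax → Type
    lhs   : (i : Ax) → Tms (axCtx i) (axTy i)
    rhs   : (i : Ax) → Tms (axCtx i) (axTy i)

-- Category data: objects, hom-setoids (up to the given equality),
-- identities and composition.  (The category laws hold for the two
-- syntactic categories below; they play no role in the statement.)
record Cat : Set₁ where
  field
    Obj  : Set
    Hom  : Obj → Obj → Set
    _≈_  : ∀ {X Y} → Hom X Y → Hom X Y → Set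
    id   : ∀ {X} → Hom X X
    _∘_  : ∀ {X Y Z} → Hom Y Z → Hom X Y → Hom X Z

module _ (C : Cat) where
  open Cat C

  IsTerminal : Obj → Set
  IsTerminal T = ∀ X → Σ[ h ∈ Hom X T ] (∀ (h' : Hom X T) → h' ≈ h)

  IsProduct : ∀ {X Y P} → Hom P X → Hom P Y → Set
  IsProduct {X} {Y} {P} p₁ p₂ =
    ∀ Z (f : Hom Z X) (g : Hom Z Y) →
      Σ[ h ∈ Hom Z P ] (((p₁ ∘ h) ≈ f × (p₂ ∘ h) ≈ g) ×
        (∀ (h' : Hom Z P) → (p₁ ∘ h') ≈ f → (p₂ ∘ h') ≈ g → h' ≈ h))

record Functor (C D : Cat) : Set where
  private module C = Cat C
  private module D = Cat D
  field
    F₀           : C.Obj → D.Obj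
    F₁           : ∀ {X Y} → C.Hom X Y → D.Hom (F₀ X) (F₀ Y)
    F-resp-≈     : ∀ {X Y} {f g : C.Hom X Y} → f C.≈ g → F₁ f D.≈ F₁ g
    identity     : ∀ {X} → F₁ (C.id {X}) D.≈ D.id
    homomorphism : ∀ {X Y Z} {f : C.Hom X Y} {g : C.Hom Y Z} →
                   F₁ (g C.∘ f) D.≈ (F₁ g D.∘ F₁ f)

module _ {C D : Cat} (F : Functor C D) where
  private module C = Cat C
  private module D = Cat D
  open Functor F

  Full : Set
  Full = ∀ {X Y} (g : D.Hom (F₀ X) (F₀ Y)) → Σ[ f ∈ C.Hom X Y ] (F₁ f D.≈ g)

  Faithful : Set
  Faithful = ∀ {X Y} (f g : C.Hom X Y) → F₁ f D.≈ F₁ g → f C.≈ g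

  EssentiallySurjective : Set
  EssentiallySurjective = ∀ (Y : D.Obj) → Σ[ X ∈ C.Obj ]
    Σ[ u ∈ D.Hom (F₀ X) Y ] Σ[ v ∈ D.Hom Y (F₀ X) ]
      ((v D.∘ u) D.≈ D.id × (u D.∘ v) D.≈ D.id)

  IsEquivalence : Set
  IsEquivalence = Full × Faithful × EssentiallySurjective

  PreservesFiniteProducts : Set
  PreservesFiniteProducts =
    (∀ X → IsTerminal C X → IsTerminal D (F₀ X)) ×
    (∀ {X Y P} (p₁ : C.Hom P X) (p₂ : C.Hom P Y) →
       IsProduct C p₁ p₂ → IsProduct D (F₁ p₁) (F₁ p₂))

module _ (𝕋 : Theory) where
  open Theory 𝕋

  -- Provable equality x : A ⊢ s =_B t in the monoidal deductive system:
  -- axioms, reflexivity, symmetry, transitivity, substitution, tensor,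
  -- and the structural rules (weakening / exchange / contraction, i.e.
  -- action of renamings of the context).
  data _≈ᴹ_ : ∀ {A B} → Tms A B → Tms A B → Set where
    axiom  : (i : Ax) → lhs i ≈ᴹ rhs i
    refl   : ∀ {A B} {s : Tms A B} → s ≈ᴹ s
    sym    : ∀ {A B} {s t : Tms A B} → s ≈ᴹ t → t ≈ᴹ s
    trans  : ∀ {A B} {s t u : Tms A B} → s ≈ᴹ t → t ≈ᴹ u → s ≈ᴹ u
    subst  : ∀ {A B C} {s s' : Tms A B} {u u' : Tms B C} →
             s ≈ᴹ s' → u ≈ᴹ u' → (u ∘ₜ s) ≈ᴹ (u' ∘ₜ s')
    tensor : ∀ {A B C D} {s s' : Tms A B} {u u' : Tms C D} →
             s ≈ᴹ s' → u ≈ᴹ u' → (s ⊗ₜ u) ≈ᴹ (s' ⊗ₜ u')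
    struct : ∀ {A A' B} (ρ : Ren A A') {s t : Tms A B} →
             s ≈ᴹ t → rens ρ s ≈ᴹ rens ρ t
  infix 4 _≈ᴹ_

  -- Ordinary (classical, Birkhoff) equational logic for the same theory,
  -- each axiom x:A ⊢ s =_B t read componentwise.
  data _≈ᶜ_ {Γ : Type} : ∀ {s} → Tm Γ s → Tm Γ s → Set
  data _≈ᶜ*_ {Γ : Type} : ∀ {B} → Tms Γ B → Tms Γ B → Set
  data _≈ᶜ_ {Γ} where
    refl  : ∀ {s} {t : Tm Γ s} → t ≈ᶜ t
    sym   : ∀ {s} {t u : Tm Γ s} → t ≈ᶜ u → u ≈ᶜ t
    trans : ∀ {s} {t u v : Tm Γ s} →
            t ≈ᶜ u → u ≈ᶜ v → t ≈ᶜ v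
    cong  : (f : Fun) {ts us : Tms Γ (arity f)} →
            ts ≈ᶜ* us → app f ts ≈ᶜ app f us
    axiom : (i : Ax) {s : Sort} (j : axTy i ∋ s) (θ : Tms Γ (axCtx i)) →
            sub θ (lookup (lhs i) j) ≈ᶜ sub θ (lookup (rhs i) j)
  infix 4 _≈ᶜ_ _≈ᶜ*_
  data _≈ᶜ*_ {Γ} where
    []  : [] ≈ᶜ* []
    _∷_ : ∀ {s B} {t u : Tm Γ s} {ts us : Tms Γ B} →
          t ≈ᶜ u → ts ≈ᶜ* us → (t ∷ ts) ≈ᶜ* (u ∷ us)

  MonClassifying : Cat
  MonClassifying = record
    { Obj = Type ; Hom = Tms ; _≈_ = _≈ᴹ_ ; id = idTms ; _∘_ = _∘ₜ_ }

  CartClassifying : Cat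
  CartClassifying = record
    { Obj = Type ; Hom = Tms ; _≈_ = _≈ᶜ*_ ; id = idTms ; _∘_ = _∘ₜ_ }

{-# OPTIONS --safe #-}
module Submission where

-- Both classifying categories have types as objects, tensors of terms as
-- arrows and substitution as composition; they differ only in which equations
-- between terms they identify.  The two deductive systems prove the same
-- equations.  Every monoidal rule is admissible in Birkhoff equational logic,
-- the structural rules being renamings and hence substitutions.  Conversely, a
-- classical axiom instance is a substitution instance of a component of a
-- monoidal axiom, and equations between tensors are assembled from their
-- components by tensoring and then contracting the duplicated context.  So the
-- identity on types and terms is a functor which is bijective on objects, full
-- and faithful, and preserves and reflects every equation, hence all products.

open import Defs hiding (_≈ᴹ_; _≈ᶜ_; _≈ᶜ*_)
open import Data.List using ([]; _∷_; _++_)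
open import Data.Product using (Σ-syntax; _×_; _,_)
open import Relation.Binary.PropositionalEquality as ≡ using (_≡_; refl)

withHomEquality : (C : Cat) → (∀ {X Y} → Cat.Hom C X Y → Cat.Hom C X Y → Set) → Cat
withHomEquality C _≈'_ = record C { _≈_ = _≈'_ }

module IdentityFunctor (C : Cat) {_≈'_ : ∀ {X Y} → Cat.Hom C X Y → Cat.Hom C X Y → Set}
  (≈-refl : ∀ {X Y} {f : Cat.Hom C X Y} → Cat._≈_ C f f)
  (≈⇒≈' : ∀ {X Y} {f g : Cat.Hom C X Y} → Cat._≈_ C f g → f ≈' g)
  (≈'⇒≈ : ∀ {X Y} {f g : Cat.Hom C X Y} → f ≈' g → Cat._≈_ C f g)
  where
  open Cat C

  idFunctor : Functor C (withHomEquality C _≈'_)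
  idFunctor = record
    { F₀ = λ X → X ; F₁ = λ f → f ; F-resp-≈ = ≈⇒≈'
    ; identity = ≈⇒≈' ≈-refl ; homomorphism = ≈⇒≈' ≈-refl }

  idFunctor-isEquivalence : (∀ {X} → (id ∘ id) ≈ id {X}) → IsEquivalence idFunctor
  idFunctor-isEquivalence id∘id≈id =
    (λ g → g , ≈⇒≈' ≈-refl) ,
    (λ f g → ≈'⇒≈) ,
    (λ Y → Y , id , id , ≈⇒≈' id∘id≈id , ≈⇒≈' id∘id≈id)

  idFunctor-preservesFiniteProducts : PreservesFiniteProducts idFunctor
  idFunctor-preservesFiniteProducts = preservesTerminal , preservesProduct
    where
    preservesTerminal : ∀ T → IsTerminal C T → IsTerminal (withHomEquality C _≈'_) T
    preservesTerminal T terminal X with terminal X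
    ... | h , unique = h , λ h' → ≈⇒≈' (unique h')

    preservesProduct : ∀ {X Y P} (p₁ : Hom P X) (p₂ : Hom P Y) →
      IsProduct C p₁ p₂ → IsProduct (withHomEquality C _≈'_) p₁ p₂
    preservesProduct p₁ p₂ product Z f g with product Z f g
    ... | h , (p₁∘h≈f , p₂∘h≈g) , unique =
      h , (≈⇒≈' p₁∘h≈f , ≈⇒≈' p₂∘h≈g) ,
      λ h' p₁∘h'≈f p₂∘h'≈g → ≈⇒≈' (unique h' (≈'⇒≈ p₁∘h'≈f) (≈'⇒≈ p₂∘h'≈g))

module SubstitutionLemmas (Σ' : Signature) where
  open Syntax Σ'

  lookup-rens : ∀ {Γ Δ B s} (ρ : Ren Γ Δ) (θ : Tms Γ B) (x : B ∋ s) →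
    lookup (rens ρ θ) x ≡ ren ρ (lookup θ x)
  lookup-rens ρ (t ∷ θ) here      = refl
  lookup-rens ρ (t ∷ θ) (there x) = lookup-rens ρ θ x

  lookup-subs : ∀ {Γ Δ B s} (θ : Tms Δ Γ) (ts : Tms Γ B) (x : B ∋ s) →
    lookup (subs θ ts) x ≡ sub θ (lookup ts x)
  lookup-subs θ (t ∷ ts) here      = refl
  lookup-subs θ (t ∷ ts) (there x) = lookup-subs θ ts x

  lookup-idTms : ∀ {Γ s} (x : Γ ∋ s) → lookup idTms x ≡ var x
  lookup-idTms here      = refl
  lookup-idTms (there x) =
    ≡.trans (lookup-rens there idTms x) (≡.cong (ren there) (lookup-idTms x))

  mutual
    sub-idTms : ∀ {Γ s} (t : Tm Γ s) → sub idTms t ≡ t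
    sub-idTms (var x)    = lookup-idTms x
    sub-idTms (app f ts) = ≡.cong (app f) (subs-idTms ts)

    subs-idTms : ∀ {Γ B} (ts : Tms Γ B) → subs idTms ts ≡ ts
    subs-idTms []       = refl
    subs-idTms (t ∷ ts) = ≡.cong₂ _∷_ (sub-idTms t) (subs-idTms ts)

  mutual
    sub-∷-ren-there : ∀ {Γ Δ s r} (t : Tm Δ r) (θ : Tms Δ Γ) (u : Tm Γ s) →
      sub (t ∷ θ) (ren there u) ≡ sub θ u
    sub-∷-ren-there t θ (var x)    = refl
    sub-∷-ren-there t θ (app f us) = ≡.cong (app f) (subs-∷-rens-there t θ us)

    subs-∷-rens-there : ∀ {Γ Δ B r} (t : Tm Δ r) (θ : Tms Δ Γ) (us : Tms Γ B) →
      subs (t ∷ θ) (rens there us) ≡ subs θ us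
    subs-∷-rens-there t θ []       = refl
    subs-∷-rens-there t θ (u ∷ us) =
      ≡.cong₂ _∷_ (sub-∷-ren-there t θ u) (subs-∷-rens-there t θ us)

  subs-idTmsʳ : ∀ {Γ Δ} (θ : Tms Δ Γ) → subs θ idTms ≡ θ
  subs-idTmsʳ []      = refl
  subs-idTmsʳ (t ∷ θ) = ≡.cong (t ∷_) (≡.trans (subs-∷-rens-there t θ idTms) (subs-idTmsʳ θ))

  mutual
    sub-sub : ∀ {Γ Δ E s} (θ : Tms E Δ) (θ' : Tms Δ Γ) (t : Tm Γ s) →
      sub θ (sub θ' t) ≡ sub (subs θ θ') t
    sub-sub θ θ' (var x)    = ≡.sym (lookup-subs θ θ' x)
    sub-sub θ θ' (app f ts) = ≡.cong (app f) (subs-subs θ θ' ts)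

    subs-subs : ∀ {Γ Δ E B} (θ : Tms E Δ) (θ' : Tms Δ Γ) (ts : Tms Γ B) →
      subs θ (subs θ' ts) ≡ subs (subs θ θ') ts
    subs-subs θ θ' []       = refl
    subs-subs θ θ' (t ∷ ts) = ≡.cong₂ _∷_ (sub-sub θ θ' t) (subs-subs θ θ' ts)

  mutual
    ren-as-sub : ∀ {Γ Δ s} (ρ : Ren Γ Δ) (t : Tm Γ s) → ren ρ t ≡ sub (rens ρ idTms) t
    ren-as-sub ρ (var x)    =
      ≡.sym (≡.trans (lookup-rens ρ idTms x) (≡.cong (ren ρ) (lookup-idTms x)))
    ren-as-sub ρ (app f ts) = ≡.cong (app f) (rens-as-subs ρ ts)

    rens-as-subs : ∀ {Γ Δ B} (ρ : Ren Γ Δ) (ts : Tms Γ B) →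
      rens ρ ts ≡ subs (rens ρ idTms) ts
    rens-as-subs ρ []       = refl
    rens-as-subs ρ (t ∷ ts) = ≡.cong₂ _∷_ (ren-as-sub ρ t) (rens-as-subs ρ ts)

  mutual
    ren-ren : ∀ {Γ Δ E s} (ρ : Ren Δ E) (σ : Ren Γ Δ) (t : Tm Γ s) →
      ren ρ (ren σ t) ≡ ren (λ x → ρ (σ x)) t
    ren-ren ρ σ (var x)    = refl
    ren-ren ρ σ (app f ts) = ≡.cong (app f) (rens-rens ρ σ ts)

    rens-rens : ∀ {Γ Δ E B} (ρ : Ren Δ E) (σ : Ren Γ Δ) (ts : Tms Γ B) →
      rens ρ (rens σ ts) ≡ rens (λ x → ρ (σ x)) ts
    rens-rens ρ σ []       = refl
    rens-rens ρ σ (t ∷ ts) = ≡.cong₂ _∷_ (ren-ren ρ σ t) (rens-rens ρ σ ts)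

  mutual
    ren-≗id : ∀ {Γ s} (ρ : Ren Γ Γ) → (∀ {r} (x : Γ ∋ r) → ρ x ≡ x) →
      (t : Tm Γ s) → ren ρ t ≡ t
    ren-≗id ρ ρ≗id (var x)    = ≡.cong var (ρ≗id x)
    ren-≗id ρ ρ≗id (app f ts) = ≡.cong (app f) (rens-≗id ρ ρ≗id ts)

    rens-≗id : ∀ {Γ B} (ρ : Ren Γ Γ) → (∀ {r} (x : Γ ∋ r) → ρ x ≡ x) →
      (ts : Tms Γ B) → rens ρ ts ≡ ts
    rens-≗id ρ ρ≗id []       = refl
    rens-≗id ρ ρ≗id (t ∷ ts) = ≡.cong₂ _∷_ (ren-≗id ρ ρ≗id t) (rens-≗id ρ ρ≗id ts)

  copair : ∀ {A C Γ} → Ren A Γ → Ren C Γ → Ren (A ++ C) Γ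
  copair {[]}    f g x         = g x
  copair {a ∷ A} f g here      = f here
  copair {a ∷ A} f g (there x) = copair {A} (λ y → f (there y)) g x

  copair-inl : ∀ {A C Γ s} (f : Ren A Γ) (g : Ren C Γ) (x : A ∋ s) →
    copair {A} {C} f g (inl x) ≡ f x
  copair-inl f g here      = refl
  copair-inl f g (there x) = copair-inl (λ y → f (there y)) g x

  copair-inr : ∀ {A C Γ s} (f : Ren A Γ) (g : Ren C Γ) (x : C ∋ s) →
    copair {A} {C} f g (inr {A} x) ≡ g x
  copair-inr {[]}    f g x = refl
  copair-inr {a ∷ A} f g x = copair-inr {A} (λ y → f (there y)) g x

  contract : ∀ {Γ} → Ren (Γ ++ Γ) Γ
  contract {Γ} = copair {Γ} {Γ} (λ x → x) (λ x → x)

  contract-⊗ₜ : ∀ {Γ s B} (t : Tm Γ s) (ts : Tms Γ B) →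
    rens (contract {Γ}) ((t ∷ []) ⊗ₜ ts) ≡ t ∷ ts
  contract-⊗ₜ {Γ} t ts = ≡.cong₂ _∷_
    (≡.trans (ren-ren (contract {Γ}) (inl {Γ} {Γ}) t)
             (ren-≗id _ (copair-inl {Γ} {Γ} (λ x → x) (λ x → x)) t))
    (≡.trans (rens-rens (contract {Γ}) (inr {Γ} {Γ}) ts)
             (rens-≗id _ (copair-inr {Γ} {Γ} (λ x → x) (λ x → x)) ts))

module EquationalLogic (𝕋 : Theory) where
  open Theory 𝕋
  open SubstitutionLemmas sig

  infix 4 _≈ᴹ_ _≈ᶜ_ _≈ᶜ*_

  _≈ᴹ_ : ∀ {A B} → Tms A B → Tms A B → Set
  _≈ᴹ_ = Defs._≈ᴹ_ 𝕋

  _≈ᶜ_ : ∀ {Γ s} → Tm Γ s → Tm Γ s → Set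
  _≈ᶜ_ = Defs._≈ᶜ_ 𝕋

  _≈ᶜ*_ : ∀ {Γ B} → Tms Γ B → Tms Γ B → Set
  _≈ᶜ*_ = Defs._≈ᶜ*_ 𝕋

  ≈ᶜ*-refl : ∀ {Γ B} {ts : Tms Γ B} → ts ≈ᶜ* ts
  ≈ᶜ*-refl {ts = []}     = []
  ≈ᶜ*-refl {ts = t ∷ ts} = refl ∷ ≈ᶜ*-refl

  ≈ᶜ*-sym : ∀ {Γ B} {ts us : Tms Γ B} → ts ≈ᶜ* us → us ≈ᶜ* ts
  ≈ᶜ*-sym []       = []
  ≈ᶜ*-sym (e ∷ es) = sym e ∷ ≈ᶜ*-sym es

  ≈ᶜ*-trans : ∀ {Γ B} {ts us vs : Tms Γ B} → ts ≈ᶜ* us → us ≈ᶜ* vs → ts ≈ᶜ* vs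
  ≈ᶜ*-trans []       []       = []
  ≈ᶜ*-trans (e ∷ es) (f ∷ fs) = trans e f ∷ ≈ᶜ*-trans es fs

  ≈ᶜ*-pointwise : ∀ {Γ B} (ts us : Tms Γ B) →
    (∀ {s} (j : B ∋ s) → lookup ts j ≈ᶜ lookup us j) → ts ≈ᶜ* us
  ≈ᶜ*-pointwise []       []       e = []
  ≈ᶜ*-pointwise (t ∷ ts) (u ∷ us) e = e here ∷ ≈ᶜ*-pointwise ts us (λ j → e (there j))

  lookup-resp-≈ᶜ* : ∀ {Γ B s} {θ θ' : Tms Γ B} → θ ≈ᶜ* θ' → (x : B ∋ s) →
    lookup θ x ≈ᶜ lookup θ' x
  lookup-resp-≈ᶜ* (e ∷ es) here      = e
  lookup-resp-≈ᶜ* (e ∷ es) (there x) = lookup-resp-≈ᶜ* es x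

  ++ₜ-resp-≈ᶜ* : ∀ {Γ B D} {s s' : Tms Γ B} {u u' : Tms Γ D} →
    s ≈ᶜ* s' → u ≈ᶜ* u' → (s ++ₜ u) ≈ᶜ* (s' ++ₜ u')
  ++ₜ-resp-≈ᶜ* []       f = f
  ++ₜ-resp-≈ᶜ* (e ∷ es) f = e ∷ ++ₜ-resp-≈ᶜ* es f

  mutual
    sub-cong : ∀ {Γ Δ s} {θ θ' : Tms Δ Γ} → θ ≈ᶜ* θ' → (t : Tm Γ s) → sub θ t ≈ᶜ sub θ' t
    sub-cong e (var x)    = lookup-resp-≈ᶜ* e x
    sub-cong e (app f ts) = cong f (subs-cong e ts)

    subs-cong : ∀ {Γ Δ B} {θ θ' : Tms Δ Γ} → θ ≈ᶜ* θ' → (ts : Tms Γ B) →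
      subs θ ts ≈ᶜ* subs θ' ts
    subs-cong e []       = []
    subs-cong e (t ∷ ts) = sub-cong e t ∷ subs-cong e ts

  mutual
    sub-resp-≈ᶜ : ∀ {Γ Δ s} (θ : Tms Δ Γ) {t u : Tm Γ s} → t ≈ᶜ u → sub θ t ≈ᶜ sub θ u
    sub-resp-≈ᶜ θ refl        = refl
    sub-resp-≈ᶜ θ (sym e)     = sym (sub-resp-≈ᶜ θ e)
    sub-resp-≈ᶜ θ (trans e f) = trans (sub-resp-≈ᶜ θ e) (sub-resp-≈ᶜ θ f)
    sub-resp-≈ᶜ θ (cong f es) = cong f (subs-resp-≈ᶜ* θ es)
    sub-resp-≈ᶜ θ (axiom i j θ') =
      ≡.subst₂ _≈ᶜ_ (≡.sym (sub-sub θ θ' (lookup (lhs i) j)))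
                    (≡.sym (sub-sub θ θ' (lookup (rhs i) j)))
                    (axiom i j (subs θ θ'))

    subs-resp-≈ᶜ* : ∀ {Γ Δ B} (θ : Tms Δ Γ) {ts us : Tms Γ B} → ts ≈ᶜ* us →
      subs θ ts ≈ᶜ* subs θ us
    subs-resp-≈ᶜ* θ []       = []
    subs-resp-≈ᶜ* θ (e ∷ es) = sub-resp-≈ᶜ θ e ∷ subs-resp-≈ᶜ* θ es

  rens-resp-≈ᶜ* : ∀ {Γ Δ B} (ρ : Ren Γ Δ) {ts us : Tms Γ B} → ts ≈ᶜ* us →
    rens ρ ts ≈ᶜ* rens ρ us
  rens-resp-≈ᶜ* ρ {ts} {us} e =
    ≡.subst₂ _≈ᶜ*_ (≡.sym (rens-as-subs ρ ts)) (≡.sym (rens-as-subs ρ us))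
      (subs-resp-≈ᶜ* (rens ρ idTms) e)

  ≈ᴹ⇒≈ᶜ* : ∀ {A B} {s t : Tms A B} → s ≈ᴹ t → s ≈ᶜ* t
  ≈ᴹ⇒≈ᶜ* (axiom i) = ≈ᶜ*-pointwise (lhs i) (rhs i) λ j →
    ≡.subst₂ _≈ᶜ_ (sub-idTms (lookup (lhs i) j)) (sub-idTms (lookup (rhs i) j))
      (axiom i j idTms)
  ≈ᴹ⇒≈ᶜ* refl        = ≈ᶜ*-refl
  ≈ᴹ⇒≈ᶜ* (sym e)     = ≈ᶜ*-sym (≈ᴹ⇒≈ᶜ* e)
  ≈ᴹ⇒≈ᶜ* (trans e f) = ≈ᶜ*-trans (≈ᴹ⇒≈ᶜ* e) (≈ᴹ⇒≈ᶜ* f)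
  ≈ᴹ⇒≈ᶜ* (subst {s' = s'} {u = u} e f) =
    ≈ᶜ*-trans (subs-cong (≈ᴹ⇒≈ᶜ* e) u) (subs-resp-≈ᶜ* s' (≈ᴹ⇒≈ᶜ* f))
  ≈ᴹ⇒≈ᶜ* (tensor {A} {C = C} e f) =
    ++ₜ-resp-≈ᶜ* (rens-resp-≈ᶜ* (inl {A} {C}) (≈ᴹ⇒≈ᶜ* e))
                 (rens-resp-≈ᶜ* (inr {A} {C}) (≈ᴹ⇒≈ᶜ* f))
  ≈ᴹ⇒≈ᶜ* (struct ρ e) = rens-resp-≈ᶜ* ρ (≈ᴹ⇒≈ᶜ* e)

  ∷-resp-≈ᴹ : ∀ {Γ s B} {t u : Tm Γ s} {ts us : Tms Γ B} →
    (t ∷ []) ≈ᴹ (u ∷ []) → ts ≈ᴹ us → (t ∷ ts) ≈ᴹ (u ∷ us)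
  ∷-resp-≈ᴹ {Γ} {t = t} {u} {ts} {us} e f =
    ≡.subst₂ _≈ᴹ_ (contract-⊗ₜ t ts) (contract-⊗ₜ u us) (struct (contract {Γ}) (tensor e f))

  mutual
    ≈ᶜ⇒≈ᴹ : ∀ {Γ s} {t u : Tm Γ s} → t ≈ᶜ u → (t ∷ []) ≈ᴹ (u ∷ [])
    ≈ᶜ⇒≈ᴹ refl        = refl
    ≈ᶜ⇒≈ᴹ (sym e)     = sym (≈ᶜ⇒≈ᴹ e)
    ≈ᶜ⇒≈ᴹ (trans e f) = trans (≈ᶜ⇒≈ᴹ e) (≈ᶜ⇒≈ᴹ f)
    ≈ᶜ⇒≈ᴹ (cong f {ts} {us} es) =
      ≡.subst₂ (λ vs ws → (app f vs ∷ []) ≈ᴹ (app f ws ∷ [])) (subs-idTmsʳ ts) (subs-idTmsʳ us)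
        (subst {u = app f idTms ∷ []} (≈ᶜ*⇒≈ᴹ es) refl)
    ≈ᶜ⇒≈ᴹ (axiom i j θ) =
      subst {u = lookup (lhs i) j ∷ []} (refl {s = θ}) (subst {u = var j ∷ []} (axiom i) refl)

    ≈ᶜ*⇒≈ᴹ : ∀ {Γ B} {ts us : Tms Γ B} → ts ≈ᶜ* us → ts ≈ᴹ us
    ≈ᶜ*⇒≈ᴹ []       = refl
    ≈ᶜ*⇒≈ᴹ (e ∷ es) = ∷-resp-≈ᴹ (≈ᶜ⇒≈ᴹ e) (≈ᶜ*⇒≈ᴹ es)

  idTms∘idTms≈ᴹidTms : ∀ {Γ} → (idTms ∘ₜ idTms) ≈ᴹ (idTms {Γ})
  idTms∘idTms≈ᴹidTms = ≡.subst ((idTms ∘ₜ idTms) ≈ᴹ_) (subs-idTmsʳ idTms) refl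

proposition6p2 : (𝕋 : Theory) →
    Σ[ F ∈ Functor (MonClassifying 𝕋) (CartClassifying 𝕋) ]
      (IsEquivalence F × PreservesFiniteProducts F)
proposition6p2 𝕋 =
  idFunctor ,
  idFunctor-isEquivalence idTms∘idTms≈ᴹidTms ,
  idFunctor-preservesFiniteProducts
  where
  open EquationalLogic 𝕋
  open IdentityFunctor (MonClassifying 𝕋) refl ≈ᴹ⇒≈ᶜ* ≈ᶜ*⇒≈ᴹ
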